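{- For integers $u$ and nonnegative integers $d$, let $$\mathbf{M}^u_d(z;\theta)=\sum_{k=0}^{d}\binom{d}{k}\prod_{i=0}^{k-1}(\theta+\rho_i^2)\prod_{i=k+1}^{d}(z-i)(z+i+u-d),\qquad\rho_i=i+\tfrac12.$$ Then $\mathbf{M}^u_0=1$ for all $u$, and for every integer $u$ and every integer $d\ge1$, $$\mathbf{M}^u_d=\big(\theta+(z+\rho_{u-d})^2\big)\mathbf{M}^u_{d-1}-u(z+u)\mathbf{M}^{u-1}_{d-1}.$$
   Context: $z,\theta$ are indeterminates; the identities are polynomial identities in $z,\theta$. -}

module Defs where

open import Level using (Level)
open import Algebra.Bundles using (CommutativeRing)
open import Data.Nat using (ℕ; zero; suc; _∸_)
import Data.Nat as ℕ
open import Data.Nat.Combinatorics using (_C_)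
open import Data.Integer using (ℤ; +_; -[1+_])

module Poly {c ℓ : Level} (R : CommutativeRing c ℓ) where
  open CommutativeRing R

  ℕ→R : ℕ → Carrier
  ℕ→R zero    = 0#
  ℕ→R (suc n) = 1# + ℕ→R n

  ℤ→R : ℤ → Carrier
  ℤ→R (+ n)      = ℕ→R n
  ℤ→R -[1+ n ]   = - (1# + ℕ→R n)

  sumTo : ℕ → (ℕ → Carrier) → Carrier
  sumTo zero    f = 0#
  sumTo (suc n) f = sumTo n f + f n

  prodFrom : ℕ → ℕ → (ℕ → Carrier) → Carrier
  prodFrom a zero    f = 1#
  prodFrom a (suc n) f = f a * prodFrom (suc a) n f

  sq : Carrier → Carrier
  sq x = x * x

  -- Given h with h + h = 1 (i.e. h = 1/2):  ρ_i = i + 1/2, for integer i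
  ρ : Carrier → ℤ → Carrier
  ρ h i = ℤ→R i + h

  M : (h z θ : Carrier) → ℤ → ℕ → Carrier
  M h z θ u d =
    sumTo (suc d) (λ k →
      ℕ→R (d C k)
      * prodFrom 0 k (λ i → θ + sq (ρ h (+ i)))
      * prodFrom (suc k) (d ∸ k)
          (λ i → (z - ℕ→R i) * (z + ℕ→R i + ℤ→R u - ℕ→R d)))

module Submission where

-- Write A_k = ∏_{i<k} (θ + ρ_i²), p_i = z - i and r_i = z + i + u - d - 1. Then
-- M^u_{d+1} = Σ_k C(d+1,k) X_k with X_k = A_k ∏_{i=k+1}^{d+1} p_i r_i, which by Pascal's rule is
-- Σ_k C(d,k) (X_k + X_{k+1}). For each k ≤ d, X_k + X_{k+1} is the k-th summand of
-- (θ + (z + ρ_{u-d-1})²) M^u_d - u(z+u) M^{u-1}_d plus the correction k Y_k - (d - k) Y_{k+1},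
-- where Y_k = A_k ∏_{i=k+1}^{d} p_i ∏_{i=k+1}^{d+1} r_i; once the products common to all terms are
-- pulled out, this is a polynomial identity (using 2h = 1). The corrections cancel in the
-- binomially weighted sum because (k+1) C(d,k+1) = (d - k) C(d,k).

open import Defs
open import Level using (Level)
open import Algebra.Bundles using (CommutativeRing)
open import Data.Nat using (ℕ; zero; suc; _∸_)
import Data.Nat as ℕ
import Data.Nat.Properties as ℕ
open import Data.Integer using (ℤ; +_; -[1+_]; _⊖_) renaming (_-_ to _-ℤ_)
import Data.Integer as ℤ
import Data.Integer.Properties as ℤ
open import Data.Maybe using (Maybe; just; nothing)
open import Relation.Binary.PropositionalEquality as ≡ using (_≡_)
open import Data.Product using (_×_; _,_)
open import Relation.Nullary using (yes; no)
open import Data.Nat.Combinatorics using (_C_; nC1≡n; nCk+nC[k+1]≡[n+1]C[k+1])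
open import Data.Nat.Combinatorics.Specification using (k>n⇒nCk≡0)
open import Algebra.Solver.Ring.AlmostCommutativeRing
  using (fromCommutativeRing; _-Raw-AlmostCommutative⟶_)
import Algebra.Solver.Ring as RingSolver

[k+1]*nC[k+1]≡[n∸k]*nCk : ∀ n k → suc k ℕ.* (n C suc k) ≡ (n ∸ k) ℕ.* (n C k)
[k+1]*nC[k+1]≡[n∸k]*nCk zero    zero    = ≡.refl
[k+1]*nC[k+1]≡[n∸k]*nCk zero    (suc k) = ℕ.*-zeroʳ (2 ℕ.+ k)
[k+1]*nC[k+1]≡[n∸k]*nCk (suc n) zero    =
  ≡.trans (ℕ.+-identityʳ _) (≡.trans (nC1≡n (suc n)) (≡.sym (ℕ.*-identityʳ (suc n))))
[k+1]*nC[k+1]≡[n∸k]*nCk (suc n) (suc k) = begin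
  (2 + k) * (suc n C (2 + k))              ≡⟨ ≡.cong ((2 + k) *_) (nCk+nC[k+1]≡[n+1]C[k+1] n (suc k)) ⟨
  (2 + k) * (a + b)                        ≡⟨ ℕ.*-distribˡ-+ (2 + k) a b ⟩
  (2 + k) * a + (2 + k) * b                ≡⟨ ≡.cong (λ t → (2 + k) * a + t) ([k+1]*nC[k+1]≡[n∸k]*nCk n (suc k)) ⟩
  (a + (1 + k) * a) + (n ∸ suc k) * a      ≡⟨ xy∙z≈y∙xz a ((1 + k) * a) ((n ∸ suc k) * a) ⟩
  (1 + k) * a + suc (n ∸ suc k) * a        ≡⟨ ≡.cong₂ _+_ ([k+1]*nC[k+1]≡[n∸k]*nCk n k) [1+n∸[k+1]]*a≡[n∸k]*a ⟩
  (n ∸ k) * (n C k) + (n ∸ k) * a          ≡⟨ ℕ.*-distribˡ-+ (n ∸ k) (n C k) a ⟨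
  (n ∸ k) * (n C k + a)                    ≡⟨ ≡.cong ((n ∸ k) *_) (nCk+nC[k+1]≡[n+1]C[k+1] n k) ⟩
  (n ∸ k) * (suc n C suc k)                ∎
  where
  open import Data.Nat using (_+_; _*_)
  open ≡.≡-Reasoning
  open import Algebra.Properties.CommutativeSemigroup ℕ.+-commutativeSemigroup using (xy∙z≈y∙xz)
  a b : ℕ
  a = n C suc k
  b = n C suc (suc k)
  [1+n∸[k+1]]*a≡[n∸k]*a : suc (n ∸ suc k) * a ≡ (n ∸ k) * a
  [1+n∸[k+1]]*a≡[n∸k]*a with suc k ℕ.≤? n
  ... | yes k<n = ≡.cong (_* a) (≡.sym (ℕ.+-∸-assoc 1 k<n))
  ... | no  k≮n = ≡.subst (λ c → suc (n ∸ suc k) * c ≡ (n ∸ k) * c)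
                    (≡.sym (k>n⇒nCk≡0 (ℕ.≰⇒> k≮n)))
                    (≡.trans (ℕ.*-zeroʳ (suc (n ∸ suc k))) (≡.sym (ℕ.*-zeroʳ (n ∸ k))))

module _ {c ℓ : Level} (R : CommutativeRing c ℓ) where
  open CommutativeRing R hiding (zero)
  open Poly R
  open import Algebra.Properties.Ring ring using (-0#≈0#; -‿involutive; -‿+-comm; -‿distribˡ-*; -‿distribʳ-*)
  open import Algebra.Properties.CommutativeSemigroup +-commutativeSemigroup using (interchange)
  open import Relation.Binary.Reasoning.Setoid setoid

  ℕ→R-+ : ∀ m n → ℕ→R (m ℕ.+ n) ≈ ℕ→R m + ℕ→R n
  ℕ→R-+ zero    n = sym (+-identityˡ _)
  ℕ→R-+ (suc m) n = trans (+-congˡ (ℕ→R-+ m n)) (sym (+-assoc _ _ _))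

  ℕ→R-* : ∀ m n → ℕ→R (m ℕ.* n) ≈ ℕ→R m * ℕ→R n
  ℕ→R-* zero    n = sym (zeroˡ _)
  ℕ→R-* (suc m) n = begin
    ℕ→R (n ℕ.+ m ℕ.* n)          ≈⟨ ℕ→R-+ n (m ℕ.* n) ⟩
    ℕ→R n + ℕ→R (m ℕ.* n)        ≈⟨ +-cong (sym (*-identityˡ _)) (ℕ→R-* m n) ⟩
    1# * ℕ→R n + ℕ→R m * ℕ→R n   ≈⟨ distribʳ _ _ _ ⟨
    (1# + ℕ→R m) * ℕ→R n         ∎

  1+x-[1+y]≈x-y : ∀ x y → (1# + x) - (1# + y) ≈ x - y
  1+x-[1+y]≈x-y x y = begin
    (1# + x) - (1# + y)        ≈⟨ +-congˡ (-‿+-comm 1# y) ⟨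
    (1# + x) + (- 1# + - y)    ≈⟨ interchange 1# x (- 1#) (- y) ⟩
    (1# - 1#) + (x - y)        ≈⟨ +-congʳ (-‿inverseʳ 1#) ⟩
    0# + (x - y)               ≈⟨ +-identityˡ _ ⟩
    x - y                      ∎

  ℤ→R-⊖ : ∀ m n → ℤ→R (m ⊖ n) ≈ ℕ→R m - ℕ→R n
  ℤ→R-⊖ m       zero    = trans (sym (+-identityʳ _)) (+-congˡ (sym -0#≈0#))
  ℤ→R-⊖ zero    (suc n) = sym (+-identityˡ _)
  ℤ→R-⊖ (suc m) (suc n) = begin
    ℤ→R (suc m ⊖ suc n)         ≡⟨ ≡.cong ℤ→R (ℤ.[1+m]⊖[1+n]≡m⊖n m n) ⟩
    ℤ→R (m ⊖ n)                 ≈⟨ ℤ→R-⊖ m n ⟩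
    ℕ→R m - ℕ→R n               ≈⟨ 1+x-[1+y]≈x-y _ _ ⟨
    ℕ→R (suc m) - ℕ→R (suc n)   ∎

  ℤ→R-neg : ∀ i → ℤ→R (ℤ.- i) ≈ - ℤ→R i
  ℤ→R-neg (+ zero)  = sym -0#≈0#
  ℤ→R-neg (+ suc n) = refl
  ℤ→R-neg -[1+ n ]  = sym (-‿involutive _)

  ℤ→R-+ : ∀ i j → ℤ→R (i ℤ.+ j) ≈ ℤ→R i + ℤ→R j
  ℤ→R-+ (+ m)    (+ n)    = ℕ→R-+ m n
  ℤ→R-+ (+ m)    -[1+ n ] = ℤ→R-⊖ m (suc n)
  ℤ→R-+ -[1+ m ] (+ n)    = trans (ℤ→R-⊖ n (suc m)) (+-comm _ _)
  ℤ→R-+ -[1+ m ] -[1+ n ] = begin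
    ℤ→R (-[1+ m ] ℤ.+ -[1+ n ])          ≡⟨ ≡.cong ℤ→R (ℤ.neg-distrib-+ (+ suc m) (+ suc n)) ⟨
    ℤ→R (ℤ.- (+ suc m ℤ.+ + suc n))     ≈⟨ ℤ→R-neg (+ suc m ℤ.+ + suc n) ⟩
    - ℕ→R (suc m ℕ.+ suc n)              ≈⟨ -‿cong (ℕ→R-+ (suc m) (suc n)) ⟩
    - (ℕ→R (suc m) + ℕ→R (suc n))        ≈⟨ -‿+-comm _ _ ⟨
    ℤ→R -[1+ m ] + ℤ→R -[1+ n ]          ∎

  ℤ→R-+* : ∀ m j → ℤ→R (+ m ℤ.* j) ≈ ℕ→R m * ℤ→R j
  ℤ→R-+* m (+ n) = trans (reflexive (≡.cong ℤ→R (≡.sym (ℤ.pos-* m n)))) (ℕ→R-* m n)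
  ℤ→R-+* m -[1+ n ] = begin
    ℤ→R (+ m ℤ.* -[1+ n ])            ≡⟨ ≡.cong ℤ→R (ℤ.neg-distribʳ-* (+ m) (+ suc n)) ⟨
    ℤ→R (ℤ.- (+ m ℤ.* + suc n))       ≈⟨ ℤ→R-neg (+ m ℤ.* + suc n) ⟩
    - ℤ→R (+ m ℤ.* + suc n)           ≈⟨ -‿cong (ℤ→R-+* m (+ suc n)) ⟩
    - (ℕ→R m * ℕ→R (suc n))           ≈⟨ -‿distribʳ-* _ _ ⟩
    ℕ→R m * ℤ→R -[1+ n ]              ∎

  ℤ→R-* : ∀ i j → ℤ→R (i ℤ.* j) ≈ ℤ→R i * ℤ→R j
  ℤ→R-* (+ m)    j = ℤ→R-+* m j
  ℤ→R-* -[1+ m ] j = begin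
    ℤ→R (-[1+ m ] ℤ.* j)              ≡⟨ ≡.cong ℤ→R (ℤ.neg-distribˡ-* (+ suc m) j) ⟨
    ℤ→R (ℤ.- (+ suc m ℤ.* j))         ≈⟨ ℤ→R-neg (+ suc m ℤ.* j) ⟩
    - ℤ→R (+ suc m ℤ.* j)             ≈⟨ -‿cong (ℤ→R-+* (suc m) j) ⟩
    - (ℕ→R (suc m) * ℤ→R j)           ≈⟨ -‿distribˡ-* _ _ ⟩
    ℤ→R -[1+ m ] * ℤ→R j              ∎

  -- ℤ→R (+ 1) is 1# + 0#; sending the literal 1 to 1# itself lets solver goals mention 1#.
  ⟦_⟧ℤ : ℤ → Carrier
  ⟦ + 1 ⟧ℤ = 1#
  ⟦ i   ⟧ℤ = ℤ→R i

  ⟦⟧ℤ≈ℤ→R : ∀ i → ⟦ i ⟧ℤ ≈ ℤ→R i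
  ⟦⟧ℤ≈ℤ→R (+ zero)          = refl
  ⟦⟧ℤ≈ℤ→R (+ suc zero)      = sym (+-identityʳ 1#)
  ⟦⟧ℤ≈ℤ→R (+ suc (suc n))   = refl
  ⟦⟧ℤ≈ℤ→R -[1+ n ]          = refl

  ℤ-morphism : ℤ.+-*-rawRing -Raw-AlmostCommutative⟶ fromCommutativeRing R
  ℤ-morphism = record
    { ⟦_⟧    = ⟦_⟧ℤ
    ; +-homo = λ i j → through (i ℤ.+ j) (ℤ→R-+ i j) (+-cong (⟦⟧ℤ≈ℤ→R i) (⟦⟧ℤ≈ℤ→R j))
    ; *-homo = λ i j → through (i ℤ.* j) (ℤ→R-* i j) (*-cong (⟦⟧ℤ≈ℤ→R i) (⟦⟧ℤ≈ℤ→R j))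
    ; -‿homo = λ i → through (ℤ.- i) (ℤ→R-neg i) (-‿cong (⟦⟧ℤ≈ℤ→R i))
    ; 0-homo = refl
    ; 1-homo = refl
    }
    where
    through : ∀ i {x y} → ℤ→R i ≈ x → y ≈ x → ⟦ i ⟧ℤ ≈ y
    through i p q = trans (⟦⟧ℤ≈ℤ→R i) (trans p (sym q))

  ⟦⟧ℤ-≟ : ∀ i j → Maybe (⟦ i ⟧ℤ ≈ ⟦ j ⟧ℤ)
  ⟦⟧ℤ-≟ i j with i ℤ.≟ j
  ... | yes ≡.refl = just refl
  ... | no  _      = nothing

  open RingSolver ℤ.+-*-rawRing (fromCommutativeRing R) ℤ-morphism ⟦⟧ℤ-≟
    using (solve; _:=_; _:+_; _:*_; _:-_; con)

  sumTo-cong-< : ∀ n {f g : ℕ → Carrier} → (∀ k → k ℕ.< n → f k ≈ g k) → sumTo n f ≈ sumTo n g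
  sumTo-cong-< zero    f≈g = refl
  sumTo-cong-< (suc n) f≈g =
    +-cong (sumTo-cong-< n (λ k k<n → f≈g k (ℕ.m<n⇒m<1+n k<n))) (f≈g n (ℕ.n<1+n n))

  sumTo-cong : ∀ n {f g : ℕ → Carrier} → (∀ k → f k ≈ g k) → sumTo n f ≈ sumTo n g
  sumTo-cong n f≈g = sumTo-cong-< n (λ k _ → f≈g k)

  sumTo-+ : ∀ n (f g : ℕ → Carrier) → sumTo n (λ k → f k + g k) ≈ sumTo n f + sumTo n g
  sumTo-+ zero    f g = sym (+-identityˡ 0#)
  sumTo-+ (suc n) f g = trans (+-congʳ (sumTo-+ n f g)) (interchange _ _ _ _)

  sumTo-neg : ∀ n (f : ℕ → Carrier) → sumTo n (λ k → - f k) ≈ - sumTo n f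
  sumTo-neg zero    f = sym -0#≈0#
  sumTo-neg (suc n) f = trans (+-congʳ (sumTo-neg n f)) (-‿+-comm _ _)

  sumTo-sub : ∀ n (f g : ℕ → Carrier) → sumTo n (λ k → f k - g k) ≈ sumTo n f - sumTo n g
  sumTo-sub n f g = trans (sumTo-+ n f (λ k → - g k)) (+-congˡ (sumTo-neg n g))

  sumTo-distribˡ : ∀ n a (f : ℕ → Carrier) → sumTo n (λ k → a * f k) ≈ a * sumTo n f
  sumTo-distribˡ zero    a f = sym (zeroʳ a)
  sumTo-distribˡ (suc n) a f = trans (+-congʳ (sumTo-distribˡ n a f)) (sym (distribˡ _ _ _))

  sumTo-suc : ∀ n (f : ℕ → Carrier) → sumTo (suc n) f ≈ f 0 + sumTo n (λ k → f (suc k))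
  sumTo-suc zero    f = +-comm _ _
  sumTo-suc (suc n) f = trans (+-congʳ (sumTo-suc n f)) (+-assoc _ _ _)

  prodFrom-cong : ∀ a n {f g : ℕ → Carrier} → (∀ i → f i ≈ g i) → prodFrom a n f ≈ prodFrom a n g
  prodFrom-cong a zero    f≈g = refl
  prodFrom-cong a (suc n) f≈g = *-cong (f≈g a) (prodFrom-cong (suc a) n f≈g)

  prodFrom-* : ∀ a n (f g : ℕ → Carrier) →
               prodFrom a n (λ i → f i * g i) ≈ prodFrom a n f * prodFrom a n g
  prodFrom-* a zero    f g = sym (*-identityˡ 1#)
  prodFrom-* a (suc n) f g = trans (*-congˡ (prodFrom-* (suc a) n f g)) (*-interchange _ _ _ _)
    where open import Algebra.Properties.CommutativeSemigroup *-commutativeSemigroup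
            using () renaming (interchange to *-interchange)

  prodFrom-suc : ∀ a n (f : ℕ → Carrier) → prodFrom (suc a) n f ≡ prodFrom a n (λ i → f (suc i))
  prodFrom-suc a zero    f = ≡.refl
  prodFrom-suc a (suc n) f = ≡.cong (f (suc a) *_) (prodFrom-suc (suc a) n f)

  prodFrom-snoc : ∀ a n (f : ℕ → Carrier) → prodFrom a (suc n) f ≈ prodFrom a n f * f (a ℕ.+ n)
  prodFrom-snoc a zero    f = trans (*-comm _ _) (*-congˡ (reflexive (≡.cong f (≡.sym (ℕ.+-identityʳ a)))))
  prodFrom-snoc a (suc n) f = begin
    f a * prodFrom (suc a) (suc n) f          ≈⟨ *-congˡ (prodFrom-snoc (suc a) n f) ⟩
    f a * (prodFrom (suc a) n f * f (suc a ℕ.+ n)) ≈⟨ *-assoc _ _ _ ⟨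
    prodFrom a (suc n) f * f (suc a ℕ.+ n)    ≡⟨ ≡.cong (λ i → prodFrom a (suc n) f * f i) (ℕ.+-suc a n) ⟨
    prodFrom a (suc n) f * f (a ℕ.+ suc n)    ∎

  sumTo-shift : ∀ n (g : ℕ → Carrier) → g (suc n) ≈ 0# →
                sumTo (suc n) g ≈ g 0 + sumTo (suc n) (λ k → g (suc k))
  sumTo-shift n g g[1+n]≈0 = begin
    sumTo (suc n) g                        ≈⟨ +-identityʳ _ ⟨
    sumTo (suc n) g + 0#                   ≈⟨ +-congˡ g[1+n]≈0 ⟨
    sumTo (suc (suc n)) g                  ≈⟨ sumTo-suc (suc n) g ⟩
    g 0 + sumTo (suc n) (λ k → g (suc k))  ∎

  ℕ→R-C-vanishes : ∀ d → ℕ→R (d C suc d) ≈ 0#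
  ℕ→R-C-vanishes d = reflexive (≡.cong ℕ→R (k>n⇒nCk≡0 (ℕ.n<1+n d)))

  sumTo-pascal : ∀ d (X : ℕ → Carrier) →
    sumTo (suc (suc d)) (λ k → ℕ→R (suc d C k) * X k)
      ≈ sumTo (suc d) (λ k → ℕ→R (d C k) * (X k + X (suc k)))
  sumTo-pascal d X = begin
    sumTo (suc (suc d)) f                        ≈⟨ sumTo-suc (suc d) f ⟩
    f 0 + sumTo (suc d) (λ k → f (suc k))        ≈⟨ +-congˡ (sumTo-cong (suc d) pascal) ⟩
    f 0 + sumTo (suc d) (λ k → a k + g (suc k))  ≈⟨ +-congˡ (sumTo-+ (suc d) a (λ k → g (suc k))) ⟩
    f 0 + (Σa + sumTo (suc d) (λ k → g (suc k))) ≈⟨ x∙yz≈xz∙y _ _ _ ⟩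
    (g 0 + sumTo (suc d) (λ k → g (suc k))) + Σa ≈⟨ +-congʳ (sumTo-shift d g (trans (*-congʳ (ℕ→R-C-vanishes d)) (zeroˡ _))) ⟨
    sumTo (suc d) g + Σa                         ≈⟨ sumTo-+ (suc d) g a ⟨
    sumTo (suc d) (λ k → g k + a k)              ≈⟨ sumTo-cong (suc d) (λ k → distribˡ _ _ _) ⟨
    sumTo (suc d) (λ k → ℕ→R (d C k) * (X k + X (suc k))) ∎
    where
    open import Algebra.Properties.CommutativeSemigroup +-commutativeSemigroup using (x∙yz≈xz∙y)
    f g a : ℕ → Carrier
    f k = ℕ→R (suc d C k) * X k
    g k = ℕ→R (d C k) * X k
    a k = ℕ→R (d C k) * X (suc k)
    Σa : Carrier
    Σa = sumTo (suc d) a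
    pascal : ∀ k → f (suc k) ≈ a k + g (suc k)
    pascal k = begin
      ℕ→R (suc d C suc k) * X (suc k)                      ≡⟨ ≡.cong (λ c → ℕ→R c * X (suc k)) (nCk+nC[k+1]≡[n+1]C[k+1] d k) ⟨
      ℕ→R (d C k ℕ.+ d C suc k) * X (suc k)                ≈⟨ *-congʳ (ℕ→R-+ (d C k) (d C suc k)) ⟩
      (ℕ→R (d C k) + ℕ→R (d C suc k)) * X (suc k)          ≈⟨ distribʳ _ _ _ ⟩
      a k + g (suc k)                                      ∎

  sumTo-absorption : ∀ d (Y : ℕ → Carrier) →
    sumTo (suc d) (λ k → ℕ→R (d C k) * (ℕ→R k * Y k - ℕ→R (d ∸ k) * Y (suc k))) ≈ 0#
  sumTo-absorption d Y = begin
    sumTo (suc d) (λ k → ℕ→R (d C k) * (ℕ→R k * Y k - ℕ→R (d ∸ k) * Y (suc k)))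
      ≈⟨ sumTo-cong (suc d) (λ k → trans (distribˡ _ _ _) (+-congˡ (sym (-‿distribʳ-* _ _)))) ⟩
    sumTo (suc d) (λ k → g k - ℕ→R (d C k) * (ℕ→R (d ∸ k) * Y (suc k)))
      ≈⟨ sumTo-sub (suc d) g _ ⟩
    Σg - sumTo (suc d) (λ k → ℕ→R (d C k) * (ℕ→R (d ∸ k) * Y (suc k)))
      ≈⟨ +-congˡ (-‿cong (sumTo-cong (suc d) absorb)) ⟩
    Σg - sumTo (suc d) (λ k → g (suc k))
      ≈⟨ +-congˡ (-‿cong Σg≈Σg∘suc) ⟨
    Σg - Σg
      ≈⟨ -‿inverseʳ Σg ⟩
    0# ∎
    where
    open import Algebra.Properties.CommutativeSemigroup *-commutativeSemigroup using (x∙yz≈yx∙z; xy∙z≈y∙xz)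
    g : ℕ → Carrier
    g k = ℕ→R (d C k) * (ℕ→R k * Y k)
    Σg : Carrier
    Σg = sumTo (suc d) g
    absorb : ∀ k → ℕ→R (d C k) * (ℕ→R (d ∸ k) * Y (suc k)) ≈ g (suc k)
    absorb k = begin
      ℕ→R (d C k) * (ℕ→R (d ∸ k) * Y (suc k))      ≈⟨ x∙yz≈yx∙z _ _ _ ⟩
      (ℕ→R (d ∸ k) * ℕ→R (d C k)) * Y (suc k)      ≈⟨ *-congʳ (ℕ→R-* (d ∸ k) (d C k)) ⟨
      ℕ→R ((d ∸ k) ℕ.* (d C k)) * Y (suc k)        ≡⟨ ≡.cong (λ c → ℕ→R c * Y (suc k)) ([k+1]*nC[k+1]≡[n∸k]*nCk d k) ⟨
      ℕ→R (suc k ℕ.* (d C suc k)) * Y (suc k)      ≈⟨ *-congʳ (ℕ→R-* (suc k) (d C suc k)) ⟩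
      (ℕ→R (suc k) * ℕ→R (d C suc k)) * Y (suc k)  ≈⟨ xy∙z≈y∙xz _ _ _ ⟩
      g (suc k)                                    ∎
    Σg≈Σg∘suc : Σg ≈ sumTo (suc d) (λ k → g (suc k))
    Σg≈Σg∘suc = begin
      Σg                                     ≈⟨ sumTo-shift d g (trans (*-congʳ (ℕ→R-C-vanishes d)) (zeroˡ _)) ⟩
      g 0 + sumTo (suc d) (λ k → g (suc k))  ≈⟨ +-congʳ (trans (*-congˡ (zeroˡ _)) (zeroʳ _)) ⟩
      0# + sumTo (suc d) (λ k → g (suc k))   ≈⟨ +-identityˡ _ ⟩
      sumTo (suc d) (λ k → g (suc k))        ∎

  -- Since ρ_i = i + h, these hold only up to a multiple of h + h - 1#.
  boundary-identity : ∀ z θ h U xd A →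
    let pe = z - (1# + xd)
        re = z + (1# + xd) + U - (1# + xd)
        α  = θ + (xd + h) * (xd + h)
        a  = z + (U - (1# + xd) + h)
    in A * (pe * re * 1#) + (A * α) * 1#
       ≈ ((θ + a * a) * (A * 1#) - U * (z + U) * (A * 1#)
          + (xd * (A * 1# * (re * 1#)) - 0# * ((A * α) * 1# * 1#)))
         + (h + h - 1#) * (A * (xd - z - (U - (1# + xd))))
  boundary-identity = solve 6 (λ z θ h U xd A →
    let o  = con (+ 1)
        pe = z :- (o :+ xd)
        re = z :+ (o :+ xd) :+ U :- (o :+ xd)
        α  = θ :+ (xd :+ h) :* (xd :+ h)
        a  = z :+ (U :- (o :+ xd) :+ h)
    in A :* (pe :* re :* o) :+ (A :* α) :* o
       := ((θ :+ a :* a) :* (A :* o) :- U :* (z :+ U) :* (A :* o)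
           :+ (xd :* (A :* o :* (re :* o)) :- con (+ 0) :* ((A :* α) :* o :* o)))
          :+ (h :+ h :- o) :* (A :* (xd :- z :- (U :- (o :+ xd))))) refl

  interior-identity : ∀ z θ h U xk xd A Q W →
    let p₁ = z - (1# + xk)
        r₁ = z + (1# + xk) + U - (1# + xd)
        pe = z - (1# + xd)
        re = z + (1# + xd) + U - (1# + xd)
        α  = θ + (xk + h) * (xk + h)
        a  = z + (U - (1# + xd) + h)
    in A * (p₁ * r₁ * ((Q * W) * (pe * re))) + (A * α) * ((Q * W) * (pe * re))
       ≈ ((θ + a * a) * (A * ((p₁ * Q) * (W * re))) - U * (z + U) * (A * ((p₁ * Q) * (r₁ * W)))
          + (xk * (A * (p₁ * Q) * (r₁ * (W * re))) - (xd - xk) * ((A * α) * Q * (W * re))))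
         + (h + h - 1#) * (A * Q * W * p₁ * re * (xk - z - (U - (1# + xd))))
  interior-identity = solve 9 (λ z θ h U xk xd A Q W →
    let o  = con (+ 1)
        p₁ = z :- (o :+ xk)
        r₁ = z :+ (o :+ xk) :+ U :- (o :+ xd)
        pe = z :- (o :+ xd)
        re = z :+ (o :+ xd) :+ U :- (o :+ xd)
        α  = θ :+ (xk :+ h) :* (xk :+ h)
        a  = z :+ (U :- (o :+ xd) :+ h)
    in A :* (p₁ :* r₁ :* ((Q :* W) :* (pe :* re))) :+ (A :* α) :* ((Q :* W) :* (pe :* re))
       := ((θ :+ a :* a) :* (A :* ((p₁ :* Q) :* (W :* re))) :- U :* (z :+ U) :* (A :* ((p₁ :* Q) :* (r₁ :* W)))
           :+ (xk :* (A :* (p₁ :* Q) :* (r₁ :* (W :* re))) :- (xd :- xk) :* ((A :* α) :* Q :* (W :* re))))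
          :+ (h :+ h :- o) :* (A :* Q :* W :* p₁ :* re :* (xk :- z :- (U :- (o :+ xd))))) refl

  module Recurrence (h : Carrier) (h+h≈1 : h + h ≈ 1#) (z θ : Carrier) (u : ℤ) (d : ℕ) where
    U θ+[z+ρ]² U[z+U] : Carrier
    U  = ℤ→R u
    θ+[z+ρ]² = θ + sq (z + ρ h (u -ℤ + suc d))
    U[z+U] = U * (z + U)

    α p r pr pr⁺ A : ℕ → Carrier
    α i   = θ + sq (ρ h (+ i))
    p i   = z - ℕ→R i
    r i   = z + ℕ→R i + U - ℕ→R (suc d)
    pr i  = p i * r i
    pr⁺ i = p i * r (suc i)
    A k   = prodFrom 0 k α

    factor : ℤ → ℕ → ℕ → Carrier
    factor v e i = (z - ℕ→R i) * (z + ℕ→R i + ℤ→R v - ℕ→R e)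

    summand : ℤ → ℕ → ℕ → Carrier
    summand v e k = ℕ→R (e C k) * A k * prodFrom (suc k) (e ∸ k) (factor v e)

    h+h-1≈0 : h + h - 1# ≈ 0#
    h+h-1≈0 = trans (+-congʳ h+h≈1) (-‿inverseʳ 1#)

    ≈-mod-[h+h-1] : ∀ {x y} e → x ≈ y + (h + h - 1#) * e → x ≈ y
    ≈-mod-[h+h-1] e x≈y+δe =
      trans x≈y+δe (trans (+-congˡ (trans (*-congʳ h+h-1≈0) (zeroˡ e))) (+-identityʳ _))

    θ+[z+ρ]²≈ : θ+[z+ρ]² ≈ θ + sq (z + (U - ℕ→R (suc d) + h))
    θ+[z+ρ]²≈ = +-congˡ (*-cong shift shift)
      where shift = +-congˡ (+-congʳ (ℤ→R-+ u -[1+ d ]))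

    factor-u-d : ∀ i → factor u d i ≈ pr⁺ i
    factor-u-d i = *-congˡ
      (solve 4 (λ z x U D → z :+ x :+ U :- D := z :+ (con (+ 1) :+ x) :+ U :- (con (+ 1) :+ D))
             refl z (ℕ→R i) U (ℕ→R d))

    factor-[u-1]-d : ∀ i → factor (u -ℤ + 1) d i ≈ pr i
    factor-[u-1]-d i = *-congˡ (trans (+-congʳ (+-congˡ (ℤ→R-+ u -[1+ 0 ])))
      (solve 4 (λ z x U D → z :+ x :+ (U :+ con -[1+ 0 ]) :- D := z :+ x :+ U :- (con (+ 1) :+ D))
             refl z (ℕ→R i) U (ℕ→R d)))

    A-suc : ∀ k → A (suc k) ≈ A k * α k
    A-suc k = prodFrom-snoc 0 k α

    -- Products over the n indices k+1, …, k+n: with n = d + 1 ∸ k, X k n and Y k n are X_k and Y_k,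
    -- while G k (n ∸ 1) and X k (n ∸ 1) are the summands of M^u_d and M^{u-1}_d without C(d,k).
    X G Y : ℕ → ℕ → Carrier
    X k n = A k * prodFrom (suc k) n pr
    G k n = A k * prodFrom (suc k) n pr⁺
    Y k n = A k * prodFrom (suc k) (ℕ.pred n) p * prodFrom (suc k) n r

    Step : ℕ → ℕ → Set ℓ
    Step k n = X k (suc n) + X (suc k) n
               ≈ (θ+[z+ρ]² * G k n - U[z+U] * X k n) + (ℕ→R k * Y k (suc n) - ℕ→R n * Y (suc k) n)

    step-boundary : Step d 0
    step-boundary = begin
      X d 1 + X (suc d) 0
        ≈⟨ +-congˡ (*-congʳ (A-suc d)) ⟩
      X d 1 + (A d * α d) * 1#
        ≈⟨ ≈-mod-[h+h-1] _ (boundary-identity z θ h U (ℕ→R d) (A d)) ⟩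
      ((θ + sq a) * G d 0 - U[z+U] * X d 0) + (ℕ→R d * Y d 1 - 0# * ((A d * α d) * 1# * 1#))
        ≈⟨ +-cong (+-congʳ (*-congʳ θ+[z+ρ]²≈)) (+-congˡ (-‿cong (*-congˡ (*-congʳ (*-congʳ (A-suc d)))))) ⟨
      (θ+[z+ρ]² * G d 0 - U[z+U] * X d 0) + (ℕ→R d * Y d 1 - ℕ→R 0 * Y (suc d) 0)
        ∎
      where
      a : Carrier
      a = z + (U - ℕ→R (suc d) + h)

    step-interior : ∀ k m → k ℕ.+ suc m ≡ d → Step k (suc m)
    step-interior k m k+[1+m]≡d = begin
      X k (2 ℕ.+ m) + X (suc k) (suc m)
        ≈⟨ +-cong (*-congˡ (*-congˡ Πpr)) (*-cong (A-suc k) Πpr) ⟩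
      A k * (p₁ * r₁ * ((Q * W) * (pe * re))) + (A k * α k) * ((Q * W) * (pe * re))
        ≈⟨ ≈-mod-[h+h-1] _ (interior-identity z θ h U (ℕ→R k) (ℕ→R d) (A k) Q W) ⟩
      ((θ + sq a) * (A k * ((p₁ * Q) * (W * re))) - U[z+U] * (A k * ((p₁ * Q) * (r₁ * W))))
        + (ℕ→R k * (A k * (p₁ * Q) * (r₁ * (W * re))) - (ℕ→R d - ℕ→R k) * ((A k * α k) * Q * (W * re)))
        ≈⟨ +-cong (+-cong (*-cong θ+[z+ρ]²≈ (*-congˡ Πpr⁺)) (-‿cong (*-congˡ (*-congˡ (prodFrom-* (suc k) (suc m) p r)))))
                  (+-cong (*-congˡ (*-congˡ (*-congˡ Πr))) (-‿cong (*-cong [1+m]≈d-k (*-cong (*-congʳ (A-suc k)) Πr)))) ⟨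
      (θ+[z+ρ]² * G k (suc m) - U[z+U] * X k (suc m)) + (ℕ→R k * Y k (2 ℕ.+ m) - ℕ→R (suc m) * Y (suc k) (suc m))
        ∎
      where
      p₁ r₁ pe re Q W a : Carrier
      p₁ = p (suc k)
      r₁ = r (suc k)
      pe = p (suc d)
      re = r (suc d)
      Q  = prodFrom (2 ℕ.+ k) m p
      W  = prodFrom (2 ℕ.+ k) m r
      a  = z + (U - ℕ→R (suc d) + h)

      2+k+m≡1+d : 2 ℕ.+ k ℕ.+ m ≡ suc d
      2+k+m≡1+d = ≡.cong suc (≡.trans (≡.sym (ℕ.+-suc k m)) k+[1+m]≡d)

      Π-last : ∀ {f} → prodFrom (2 ℕ.+ k) (suc m) f ≈ prodFrom (2 ℕ.+ k) m f * f (suc d)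
      Π-last {f} = trans (prodFrom-snoc (2 ℕ.+ k) m f) (*-congˡ (reflexive (≡.cong f 2+k+m≡1+d)))

      Πpr : prodFrom (2 ℕ.+ k) (suc m) pr ≈ (Q * W) * (pe * re)
      Πpr = trans Π-last (*-congʳ (prodFrom-* (2 ℕ.+ k) m p r))

      Πr : prodFrom (2 ℕ.+ k) (suc m) r ≈ W * re
      Πr = Π-last

      Πpr⁺ : prodFrom (suc k) (suc m) pr⁺ ≈ (p₁ * Q) * (W * re)
      Πpr⁺ = trans (prodFrom-* (suc k) (suc m) p (λ i → r (suc i)))
                   (*-congˡ (trans (reflexive (≡.sym (prodFrom-suc (suc k) (suc m) r))) Πr))

      [1+m]≈d-k : ℕ→R (suc m) ≈ ℕ→R d - ℕ→R k
      [1+m]≈d-k = begin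
        ℕ→R (suc m)                       ≈⟨ solve 2 (λ x y → y := x :+ y :- x) refl (ℕ→R k) (ℕ→R (suc m)) ⟩
        ℕ→R k + ℕ→R (suc m) - ℕ→R k       ≈⟨ +-congʳ (ℕ→R-+ k (suc m)) ⟨
        ℕ→R (k ℕ.+ suc m) - ℕ→R k         ≡⟨ ≡.cong (λ n → ℕ→R n - ℕ→R k) k+[1+m]≡d ⟩
        ℕ→R d - ℕ→R k                     ∎

    step-at : ∀ k n → k ℕ.+ n ≡ d → Step k n
    step-at k zero    k+0≡d with ≡.trans (≡.sym (ℕ.+-identityʳ k)) k+0≡d
    ... | ≡.refl = step-boundary
    step-at k (suc m) k+[1+m]≡d = step-interior k m k+[1+m]≡d

    step : ∀ k → k ℕ.≤ d →
      X k (suc d ∸ k) + X (suc k) (d ∸ k)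
        ≈ (θ+[z+ρ]² * G k (d ∸ k) - U[z+U] * X k (d ∸ k)) + (ℕ→R k * Y k (suc d ∸ k) - ℕ→R (d ∸ k) * Y (suc k) (d ∸ k))
    step k k≤d = ≡.subst
      (λ n → X k n + X (suc k) (d ∸ k)
               ≈ (θ+[z+ρ]² * G k (d ∸ k) - U[z+U] * X k (d ∸ k)) + (ℕ→R k * Y k n - ℕ→R (d ∸ k) * Y (suc k) (d ∸ k)))
      (≡.sym (ℕ.+-∸-assoc 1 k≤d))
      (step-at k (d ∸ k) (ℕ.m+[n∸m]≡n k≤d))

    summand-u-d : ∀ k → summand u d k ≈ ℕ→R (d C k) * G k (d ∸ k)
    summand-u-d k = trans (*-assoc _ _ _) (*-congˡ (*-congˡ (prodFrom-cong (suc k) (d ∸ k) factor-u-d)))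

    summand-[u-1]-d : ∀ k → summand (u -ℤ + 1) d k ≈ ℕ→R (d C k) * X k (d ∸ k)
    summand-[u-1]-d k = trans (*-assoc _ _ _) (*-congˡ (*-congˡ (prodFrom-cong (suc k) (d ∸ k) factor-[u-1]-d)))

    M-recurrence : M h z θ u (suc d) ≈ θ+[z+ρ]² * M h z θ u d - U[z+U] * M h z θ (u -ℤ + 1) d
    M-recurrence = begin
      sumTo (suc (suc d)) (summand u (suc d))
        ≈⟨ sumTo-cong (suc (suc d)) (λ k → *-assoc _ _ _) ⟩
      sumTo (suc (suc d)) (λ k → ℕ→R (suc d C k) * X k (suc d ∸ k))
        ≈⟨ sumTo-pascal d (λ k → X k (suc d ∸ k)) ⟩
      sumTo (suc d) (λ k → Cd k * (X k (suc d ∸ k) + X (suc k) (d ∸ k)))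
        ≈⟨ sumTo-cong-< (suc d) (λ k k<1+d → *-congˡ (step k (ℕ.≤-pred k<1+d))) ⟩
      sumTo (suc d) (λ k → Cd k * (leading k + correction k))
        ≈⟨ sumTo-cong (suc d) (λ k → distribˡ _ _ _) ⟩
      sumTo (suc d) (λ k → Cd k * leading k + Cd k * correction k)
        ≈⟨ sumTo-+ (suc d) _ _ ⟩
      sumTo (suc d) (λ k → Cd k * leading k) + sumTo (suc d) (λ k → Cd k * correction k)
        ≈⟨ +-congˡ (sumTo-absorption d (λ k → Y k (suc d ∸ k))) ⟩
      sumTo (suc d) (λ k → Cd k * leading k) + 0#
        ≈⟨ +-identityʳ _ ⟩
      sumTo (suc d) (λ k → Cd k * leading k)
        ≈⟨ sumTo-cong (suc d) distribute ⟩
      sumTo (suc d) (λ k → θ+[z+ρ]² * summand u d k - U[z+U] * summand (u -ℤ + 1) d k)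
        ≈⟨ sumTo-sub (suc d) _ _ ⟩
      sumTo (suc d) (λ k → θ+[z+ρ]² * summand u d k) - sumTo (suc d) (λ k → U[z+U] * summand (u -ℤ + 1) d k)
        ≈⟨ +-cong (sumTo-distribˡ (suc d) θ+[z+ρ]² _) (-‿cong (sumTo-distribˡ (suc d) U[z+U] _)) ⟩
      θ+[z+ρ]² * M h z θ u d - U[z+U] * M h z θ (u -ℤ + 1) d
        ∎
      where
      Cd leading correction : ℕ → Carrier
      Cd k         = ℕ→R (d C k)
      leading k       = θ+[z+ρ]² * G k (d ∸ k) - U[z+U] * X k (d ∸ k)
      correction k = ℕ→R k * Y k (suc d ∸ k) - ℕ→R (d ∸ k) * Y (suc k) (d ∸ k)
      distribute : ∀ k → Cd k * leading k ≈ θ+[z+ρ]² * summand u d k - U[z+U] * summand (u -ℤ + 1) d k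
      distribute k = begin
        Cd k * (θ+[z+ρ]² * G k (d ∸ k) - U[z+U] * X k (d ∸ k))
          ≈⟨ solve 5 (λ c a g b x → c :* (a :* g :- b :* x) := a :* (c :* g) :- b :* (c :* x)) refl
                     (Cd k) θ+[z+ρ]² (G k (d ∸ k)) U[z+U] (X k (d ∸ k)) ⟩
        θ+[z+ρ]² * (Cd k * G k (d ∸ k)) - U[z+U] * (Cd k * X k (d ∸ k))
          ≈⟨ +-cong (*-congˡ (summand-u-d k)) (-‿cong (*-congˡ (summand-[u-1]-d k))) ⟨
        θ+[z+ρ]² * summand u d k - U[z+U] * summand (u -ℤ + 1) d k
          ∎

  M₀≈1 : ∀ h z θ u → M h z θ u 0 ≈ 1#
  M₀≈1 h z θ u = trans (+-identityˡ _) (trans (*-identityʳ _) (trans (*-identityʳ _) (+-identityʳ 1#)))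

lemma4p5 : {c ℓ : Level} (R : CommutativeRing c ℓ) →
    let open CommutativeRing R
        open Poly R
    in (h : Carrier) → h + h ≈ 1# → (z θ : Carrier) →
       ((u : ℤ) → M h z θ u 0 ≈ 1#)
       × ((u : ℤ) (d : ℕ) →
           M h z θ u (suc d)
             ≈ (θ + sq (z + ρ h (u -ℤ + suc d))) * M h z θ u d
               - ℤ→R u * (z + ℤ→R u) * M h z θ (u -ℤ + 1) d)
lemma4p5 R h h+h≈1 z θ = M₀≈1 R h z θ , Recurrence.M-recurrence R h h+h≈1 z θ
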